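{- Let $N\colon\mathbb{B}^L\to\mathbb{B}^L$ be the reduced Boolean Delta-Notch system over a graph $\mathcal{G}$ as in the context. Let $x\in\mathbb{B}^L$ and let $I\subseteq C$ be nonempty such that the induced subgraph $\mathcal{G}_I$ is connected, $x_i=0$ for all $i\in I$, and $x_h=1$ for all $h\in S(I)\setminus I$. If $y\in\mathbb{B}^L$ satisfies $y_i=1$ for all $i\in I$, then $y$ is not reachable from $x$ in $AD_N$.
   Context: Let $L\ge 1$ and let $\mathcal{G}$ be an undirected connected graph without loops on the vertex set $C=\{1,\dots,L\}$. For $i\in C$ let $S(i)$ be the set of neighbours of $i$ in $\mathcal{G}$, and for $A\subseteq C$ let $S(A)=\bigcup_{i\in A}S(i)$. For $I\subseteq C$, $\mathcal{G}_I$ is the subgraph with vertex set $I$ and all edges of $\mathcal{G}$ with both endpoints in $I$. $\mathbb{B}=\{0,1\}$. The reduced Boolean Delta-Notch system is $N\colon\mathbb{B}^L\to\mathbb{B}^L$, $N_i(n)=\bigvee_{j\in S(i)}(1-n_j)$ (empty disjunction $=0$). $AD_N$ is the directed graph on $\mathbb{B}^L$ with an edge from $x$ to the state obtained by flipping coordinate $i$ whenever $N_i(x)\neq x_i$. $y$ is reachable from $x$ if there is a directed path (possibly of length zero) from $x$ to $y$. -}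

module Defs where

open import Data.Nat using (ℕ; suc)
open import Data.Bool using (Bool; true; false; not; _∧_; _∨_)
open import Data.Fin using (Fin)
open import Data.Fin.Subset using (Subset; _∈_; _∉_; Nonempty)
open import Data.Vec.Functional using (Vector; updateAt)
open import Data.Bool.ListAction using (any)
open import Data.List using () renaming (allFin to allFinL)
open import Data.Product using (Σ; ∃; _×_; _,_)
open import Relation.Binary.PropositionalEquality using (_≡_; _≢_)
open import Relation.Binary.Construct.Closure.ReflexiveTransitive using (Star)
open import Relation.Nullary using (¬_)

-- A simple undirected graph on the vertex set Fin L (vertex i+1 of the paper
-- is Fin element i), given by a Boolean adjacency function.
record Graph (L : ℕ) : Set where
  field
    adj       : Fin L → Fin L → Bool
    symmetric : ∀ i j → adj i j ≡ adj j i
    loopless  : ∀ i → adj i i ≡ false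

open Graph public

EdgeIn : ∀ {L} → Graph L → Subset L → Fin L → Fin L → Set
EdgeIn G I i j = (i ∈ I) × (j ∈ I) × (adj G i j ≡ true)

InducedConnected : ∀ {L} → Graph L → Subset L → Set
InducedConnected G I = ∀ i j → i ∈ I → j ∈ I → Star (EdgeIn G I) i j

Connected : ∀ {L} → Graph L → Set
Connected G = ∀ i j → Star (λ a b → adj G a b ≡ true) i j

-- Boolean states B^L (false = 0, true = 1).
State : ℕ → Set
State L = Vector Bool L

N : ∀ {L} → Graph L → State L → Fin L → Bool
N G n i = any (λ j → adj G i j ∧ not (n j)) (allFinL _)

ADStep : ∀ {L} → Graph L → State L → State L → Set
ADStep G x y = ∃ λ i → (N G x i ≢ x i) × (y ≡ updateAt x i not)

Reachable : ∀ {L} → Graph L → State L → State L → Set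
Reachable G = Star (ADStep G)

InNbhd : ∀ {L} → Graph L → Subset L → Fin L → Set
InNbhd G I h = ∃ λ i → (i ∈ I) × (adj G i h ≡ true)

-- Call z confined to I if some vertex of I is 0 in z and no edge of G joins a
-- 0 of I to a 0 outside I.  The initial state is confined by hypothesis, and
-- no update destroys this: a coordinate falls to 0 only when all its
-- neighbours are 1, so it creates no edge between zeros, and a coordinate
-- rises to 1 only when it has a neighbour that is 0, which lies in I if the
-- coordinate does.  A state with I all ones is not confined.
module Submission where

open import Defs
open import Data.Nat using (ℕ; suc)
open import Data.Bool using (true; false; not)
open import Data.Bool.Properties using (¬-not; not-injective; T-≡; T-∧; T-not-≡)
open import Data.Fin using (Fin)
open import Data.Fin.Subset using (Subset; _∈_; _∉_; Nonempty)
open import Data.Fin.Subset.Properties using (_∈?_)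
open import Data.Fin.Properties using (_≟_)
open import Data.List using (allFin)
open import Data.List.Relation.Unary.Any using (satisfied)
open import Data.List.Relation.Unary.Any.Properties using (any⁺; any⁻)
open import Data.List.Membership.Propositional using (lose)
open import Data.List.Membership.Propositional.Properties using (∈-allFin)
open import Data.Vec.Functional using (updateAt)
open import Data.Vec.Functional.Properties using (updateAt-updates; updateAt-minimal)
open import Data.Product using (∃; _×_; _,_; proj₂)
open import Function using (_∘_; Equivalence)
open import Relation.Binary.PropositionalEquality
  using (_≡_; _≢_; refl; sym; trans; cong; module ≡-Reasoning)
open import Relation.Binary.Construct.Closure.ReflexiveTransitive using (fold)
open import Relation.Nullary using (¬_; yes; no; contradiction)

open Equivalence using (to; from)

module _ {L : ℕ} (G : Graph L) where

  adjacent⇒distinct : ∀ {u w} → adj G u w ≡ true → u ≢ w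
  adjacent⇒distinct {u} a refl = contradiction (trans (sym a) (loopless G u)) λ ()

  N≡true⇒zero-neighbour : ∀ z i → N G z i ≡ true →
                          ∃ λ w → (adj G i w ≡ true) × (z w ≡ false)
  N≡true⇒zero-neighbour z i N≡true
    with w , edge∧zero ← satisfied (any⁻ _ (allFin _) (T-≡ .from N≡true))
    with edge , w-zero ← T-∧ .to edge∧zero
    = w , T-≡ .to edge , T-not-≡ .to w-zero

  N≡false⇒neighbours-one : ∀ z i → N G z i ≡ false →
                           ∀ {w} → adj G i w ≡ true → z w ≡ true
  N≡false⇒neighbours-one z i N≡false {w} edge with z w in zw
  ... | true  = refl
  ... | false = contradiction (trans (sym (T-≡ .to N≢true)) N≡false) λ ()
    where
    N≢true = any⁺ _ (lose (∈-allFin w) (T-∧ .from (T-≡ .from edge , T-not-≡ .from zw)))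

  module _ (z : State L) (k : Fin L) (enabled : N G z k ≢ z k) where

    private
      z′ = updateAt z k not

    N-flips : N G z k ≡ not (z k)
    N-flips = ¬-not enabled

    unflipped : ∀ {v} → k ≢ v → z′ v ≡ z v
    unflipped k≢v = updateAt-minimal _ k z (k≢v ∘ sym)

    falling⇒neighbours-one : z′ k ≡ false → ∀ {w} → adj G k w ≡ true → z′ w ≡ true
    falling⇒neighbours-one z′k≡false {w} edge = begin
      z′ w  ≡⟨ unflipped (adjacent⇒distinct edge) ⟩
      z w   ≡⟨ N≡false⇒neighbours-one z k N≡false edge ⟩
      true  ∎
      where
      open ≡-Reasoning
      zk≡true : z k ≡ true
      zk≡true = not-injective (trans (sym (updateAt-updates k z)) z′k≡false)
      N≡false : N G z k ≡ false
      N≡false = trans N-flips (cong not zk≡true)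

    rising⇒zero-neighbour : z k ≡ false → ∃ λ w → (adj G k w ≡ true) × (z′ w ≡ false)
    rising⇒zero-neighbour zk≡false
      with w , edge , zw ← N≡true⇒zero-neighbour z k (trans N-flips (cong not zk≡false))
      = w , edge , trans (unflipped (adjacent⇒distinct edge)) zw

  module _ (I : Subset L) where

    NoZeroEdgeLeaves : State L → Set
    NoZeroEdgeLeaves z = ∀ {u w} → u ∈ I → adj G u w ≡ true →
                         z u ≡ false → z w ≡ false → w ∈ I

    HasZeroIn : State L → Set
    HasZeroIn z = ∃ λ v → (v ∈ I) × (z v ≡ false)

    Confined : State L → Set
    Confined z = NoZeroEdgeLeaves z × HasZeroIn z

    noZeroEdgeLeaves-step : ∀ {z z′} → ADStep G z z′ →
                            NoZeroEdgeLeaves z → NoZeroEdgeLeaves z′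
    noZeroEdgeLeaves-step {z} (k , enabled , refl) closed {u} {w} u∈I edge z′u z′w
      with k ≟ u | k ≟ w
    ... | yes refl | _ =
      contradiction (trans (sym z′w) (falling⇒neighbours-one z k enabled z′u edge)) λ ()
    ... | no _ | yes refl =
      contradiction (trans (sym z′u) (falling⇒neighbours-one z k enabled z′w
                                        (trans (symmetric G w u) edge))) λ ()
    ... | no k≢u | no k≢w =
      closed u∈I edge (trans (sym (unflipped z k enabled k≢u)) z′u)
                      (trans (sym (unflipped z k enabled k≢w)) z′w)

    hasZeroIn-step : ∀ {z z′} → ADStep G z z′ →
                     NoZeroEdgeLeaves z → HasZeroIn z → HasZeroIn z′
    hasZeroIn-step {z} (k , enabled , refl) closed (v , v∈I , zv) with k ≟ v
    ... | no k≢v   = v , v∈I , trans (unflipped z k enabled k≢v) zv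
    ... | yes refl
      with w , edge , z′w ← rising⇒zero-neighbour z k enabled zv
      = w , closed v∈I edge zv (trans (sym (unflipped z k enabled (adjacent⇒distinct edge))) z′w)
          , z′w

    confined-reachable : ∀ {z z′} → Reachable G z z′ → Confined z → Confined z′
    confined-reachable = fold (λ z z′ → Confined z → Confined z′)
      (λ step rest (closed , has-zero) →
         rest (noZeroEdgeLeaves-step step closed , hasZeroIn-step step closed has-zero))
      (λ confined → confined)

proposition5 : (L : ℕ) (G : Graph (suc L)) → Connected G →
    (x : State (suc L)) (I : Subset (suc L)) →
    Nonempty I → InducedConnected G I →
    (∀ i → i ∈ I → x i ≡ false) →
    (∀ h → InNbhd G I h → h ∉ I → x h ≡ true) →
    (y : State (suc L)) → (∀ i → i ∈ I → y i ≡ true) →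
    ¬ Reachable G x y
proposition5 L G _ x I (v , v∈I) _ x-zero-on-I x-one-around-I y y-one-on-I x⇝y =
  y-has-no-zero-in-I (proj₂ (confined-reachable G I x⇝y (x-closed , v , v∈I , x-zero-on-I v v∈I)))
  where
  x-closed : NoZeroEdgeLeaves G I x
  x-closed {u} {w} u∈I edge _ xw with w ∈? I
  ... | yes w∈I = w∈I
  ... | no w∉I  = contradiction (trans (sym (x-one-around-I w (u , u∈I , edge) w∉I)) xw) λ ()

  y-has-no-zero-in-I : ¬ HasZeroIn G I y
  y-has-no-zero-in-I (u , u∈I , yu) = contradiction (trans (sym (y-one-on-I u u∈I)) yu) λ ()
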